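{- Let $S$ be a Dedekind domain whose ideal class group is a torsion group, and let $R$ be a ring with $S\subseteq R\subseteq\mathrm{Quot}(S)$. If $S\ne R$, then $S^\times$ has infinite index in $R^\times$.
   Context: $\mathrm{Quot}(S)$ denotes the field of fractions of $S$. -}

module Defs where

open import Level using (_⊔_)
open import Algebra.Bundles using (CommutativeRing)
open import Data.Nat using (ℕ; zero; suc)
open import Data.Fin using (Fin)
open import Data.Product using (Σ; ∃; ∃₂; _×_; _,_)
open import Relation.Nullary using (¬_)
open import Relation.Unary using (Pred; _⊆_)

-- Everything lives inside an ambient commutative ring K (with setoid equality ≈),
-- which will be assumed to be a field, the field of fractions Quot(S) of S.
module _ {c ℓ : Level.Level} (K : CommutativeRing c ℓ) where
  open CommutativeRing K

  Subset : Set _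
  Subset = Pred Carrier (c ⊔ ℓ)

  Same : Subset → Subset → Set _
  Same A B = (A ⊆ B) × (B ⊆ A)

  record IsSubring (A : Subset) : Set (c ⊔ ℓ) where
    field
      resp       : ∀ {x y} → x ≈ y → A x → A y
      has-0      : A 0#
      has-1      : A 1#
      +-closed   : ∀ {x y} → A x → A y → A (x + y)
      neg-closed : ∀ {x} → A x → A (- x)
      *-closed   : ∀ {x y} → A x → A y → A (x * y)

  IsField : Set (c ⊔ ℓ)
  IsField = (¬ (1# ≈ 0#)) × (∀ x → ¬ (x ≈ 0#) → ∃ λ y → x * y ≈ 1#)

  IsFractionFieldOf : Subset → Set (c ⊔ ℓ)
  IsFractionFieldOf S =
    ∀ x → ∃₂ λ a b → S a × S b × (¬ (b ≈ 0#)) × (x * b ≈ a)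

  module _ (S : Subset) where

    record IsSModule (M : Subset) : Set (c ⊔ ℓ) where
      field
        resp      : ∀ {x y} → x ≈ y → M x → M y
        has-0     : M 0#
        +-closed  : ∀ {x y} → M x → M y → M (x + y)
        smul      : ∀ {s m} → S s → M m → M (s * m)

    Nonzero : Subset → Set (c ⊔ ℓ)
    Nonzero M = ∃ λ x → M x × (¬ (x ≈ 0#))

    IsNonzeroIdeal : Subset → Set (c ⊔ ℓ)
    IsNonzeroIdeal I = IsSModule I × (I ⊆ S) × Nonzero I

    IsFractionalIdeal : Subset → Set (c ⊔ ℓ)
    IsFractionalIdeal M =
      IsSModule M × Nonzero M ×
      (∃ λ d → S d × (¬ (d ≈ 0#)) × (∀ {m} → M m → S (d * m)))

    IsPrincipal : Subset → Set (c ⊔ ℓ)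
    IsPrincipal M =
      ∃ λ x → (¬ (x ≈ 0#)) × Same M (λ y → ∃ λ s → S s × (y ≈ x * s))

  data Prod (M N : Subset) : Carrier → Set (c ⊔ ℓ) where
    p-zero : ∀ {x} → x ≈ 0# → Prod M N x
    p-step : ∀ {x m n y} → M m → N n → Prod M N y → x ≈ (m * n) + y → Prod M N x

  -- M ^⁺ n  is the (n+1)-th power of M
  _^⁺_ : Subset → ℕ → Subset
  M ^⁺ zero  = M
  M ^⁺ suc n = Prod M (M ^⁺ n)

  module _ (S : Subset) where

    -- Dedekind domain (invertible-ideal definition): S is an integral domain
    -- (automatic, being a subring of the field K) in which every nonzero
    -- ideal I is invertible: I J = S for some fractional ideal J.
    IsDedekind : Set _
    IsDedekind =
      ∀ (I : Subset) → IsNonzeroIdeal S I →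
        ∃ λ (J : Subset) → IsFractionalIdeal S J × Same (Prod I J) S

    -- the ideal class group of S is torsion: the class of every nonzero
    -- fractional ideal has finite order, i.e. some positive power is principal
    ClassGroupTorsion : Set _
    ClassGroupTorsion =
      ∀ (M : Subset) → IsFractionalIdeal S M →
        ∃ λ n → IsPrincipal S (M ^⁺ n)

    Unit : Subset → Subset
    Unit A x = A x × (∃ λ y → A y × (x * y ≈ 1#))

    FiniteIndex : Subset → Set _
    FiniteIndex R =
      ∃ λ n → Σ (Fin n → Carrier) λ u →
        (∀ i → Unit R (u i)) ×
        (∀ x → Unit R x → ∃₂ λ i s → Unit S s × (x ≈ s * u i))

-- Write x ∈ R as a/b with a, b ∈ S and let I = b (a, b)⁻¹, an integral ideal of S.
-- Since (a, b) ⊆ bR, the extension IR is all of R. As the class group is torsion,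
-- Iⁿ = πS for some π ∈ S, and IR = R forces πR = R, so π ∈ R^×. If S^× had finite
-- index in R^×, two powers of π would lie in the same coset, so a positive power of
-- π, and hence π itself, would be a unit of S. Then I = S, so 1 = b l with
-- l ∈ (a, b)⁻¹ and x = a l ∈ S.
module Submission where

open import Defs
open import Level using (Level)
open import Algebra.Bundles using (CommutativeRing)
open import Relation.Nullary using (¬_)
open import Relation.Unary using (_⊆_)
open import Data.Nat as ℕ using (zero; suc)
open import Data.Nat.Properties using (n<1+n; m≤n⇒∃[o]m+o≡n; +-suc)
open import Data.Fin using (toℕ)
open import Data.Fin.Properties using (pigeonhole)
open import Data.Product using (∃; ∃₂; _×_; _,_; proj₁)
import Relation.Binary.PropositionalEquality as ≡

module _ {c ℓ : Level} (K : CommutativeRing c ℓ) where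

  open CommutativeRing K
  open import Algebra.Properties.Semiring.Exp semiring using (_^_; ^-homo-*)
  open import Algebra.Properties.CommutativeSemigroup *-commutativeSemigroup
    using (interchange; x∙yz≈y∙xz; xy∙z≈xz∙y)
  open import Algebra.Solver.Ring.NaturalCoefficients.Default commutativeSemiring
    using (solve; _:*_; _:+_; _:=_)
  open import Relation.Binary.Reasoning.Setoid setoid

  infix 7 _·_
  _·_ : Carrier → Subset K → Subset K
  (x · M) y = ∃ λ m → M m × (y ≈ x * m)

  Span₂ : Subset K → Carrier → Carrier → Subset K
  Span₂ T a b y = ∃₂ λ s t → T s × T t × (y ≈ s * a + t * b)

  ∈Prod : ∀ {M N m n} → M m → N n → Prod K M N (m * n)
  ∈Prod Mm Nn = p-step Mm Nn (p-zero refl) (sym (+-identityʳ _))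

  *-nonzero : IsField K → ∀ {x y} → ¬ x ≈ 0# → ¬ y ≈ 0# → ¬ x * y ≈ 0#
  *-nonzero (_ , inverse) {x} {y} x≉0 y≉0 xy≈0 with x⁻¹ , xx⁻¹≈1 ← inverse x x≉0 =
    y≉0 (begin
      y              ≈⟨ *-identityˡ y ⟨
      1# * y         ≈⟨ *-congʳ (trans (*-comm x⁻¹ x) xx⁻¹≈1) ⟨
      x⁻¹ * x * y    ≈⟨ *-assoc x⁻¹ x y ⟩
      x⁻¹ * (x * y)  ≈⟨ *-congˡ xy≈0 ⟩
      x⁻¹ * 0#       ≈⟨ zeroʳ x⁻¹ ⟩
      0#             ∎)

  IsSubring⇒IsSModule : ∀ {A} → IsSubring K A → IsSModule K A A
  IsSubring⇒IsSModule sA = record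
    { resp = resp ; has-0 = has-0 ; +-closed = +-closed ; smul = *-closed }
    where open IsSubring sA

  IsSModule-restrict : ∀ {T T′ M} → T′ ⊆ T → IsSModule K T M → IsSModule K T′ M
  IsSModule-restrict T′⊆T mM = record
    { resp = resp ; has-0 = has-0 ; +-closed = +-closed ; smul = λ T′s → smul (T′⊆T T′s) }
    where open IsSModule mM

  ·-IsSModule : ∀ {T M} x → IsSModule K T M → IsSModule K T (x · M)
  ·-IsSModule x mM = record
    { resp     = λ { e (m , Mm , eq) → m , Mm , trans (sym e) eq }
    ; has-0    = 0# , has-0 , sym (zeroʳ x)
    ; +-closed = λ { (m , Mm , eq) (m′ , Mm′ , eq′) →
        m + m′ , +-closed Mm Mm′ , trans (+-cong eq eq′) (sym (distribˡ x m m′)) }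
    ; smul     = λ { {s} Ts (m , Mm , eq) →
        s * m , smul Ts Mm , trans (*-congˡ eq) (x∙yz≈y∙xz s x m) }
    }
    where open IsSModule mM

  Span₂-IsSModule : ∀ {T} → IsSubring K T → ∀ a b → IsSModule K T (Span₂ T a b)
  Span₂-IsSModule sT a b = record
    { resp     = λ { e (s , t , Ts , Tt , eq) → s , t , Ts , Tt , trans (sym e) eq }
    ; has-0    = 0# , 0# , has-0 , has-0 , sym (trans (+-cong (zeroˡ a) (zeroˡ b)) (+-identityˡ 0#))
    ; +-closed = λ { (s , t , Ts , Tt , eq) (s′ , t′ , Ts′ , Tt′ , eq′) →
        s + s′ , t + t′ , +-closed Ts Ts′ , +-closed Tt Tt′ ,
        trans (+-cong eq eq′) (solve 6 (λ s t s′ t′ a b →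
          (s :* a :+ t :* b) :+ (s′ :* a :+ t′ :* b) := (s :+ s′) :* a :+ (t :+ t′) :* b) refl s t s′ t′ a b) }
    ; smul     = λ { {r} Tr (s , t , Ts , Tt , eq) →
        r * s , r * t , *-closed Tr Ts , *-closed Tr Tt ,
        trans (*-congˡ eq) (solve 5 (λ r s t a b →
          r :* (s :* a :+ t :* b) := (r :* s) :* a :+ (r :* t) :* b) refl r s t a b) }
    }
    where open IsSubring sT

  Span₂-least : ∀ {T M a b} → IsSModule K T M → M a → M b → Span₂ T a b ⊆ M
  Span₂-least mM Ma Mb (s , t , Ts , Tt , eq) = resp (sym eq) (+-closed (smul Ts Ma) (smul Tt Mb))
    where open IsSModule mM

  ∈Span₂ˡ : ∀ {T} → IsSubring K T → ∀ a b → Span₂ T a b a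
  ∈Span₂ˡ sT a b = 1# , 0# , has-1 , has-0 , sym (trans (+-cong (*-identityˡ a) (zeroˡ b)) (+-identityʳ a))
    where open IsSubring sT

  ∈Span₂ʳ : ∀ {T} → IsSubring K T → ∀ a b → Span₂ T a b b
  ∈Span₂ʳ sT a b = 0# , 1# , has-0 , has-1 , sym (trans (+-cong (zeroˡ a) (*-identityˡ b)) (+-identityˡ b))
    where open IsSubring sT

  Prod-⊆ˡ : ∀ {T M N} → IsSModule K T M → N ⊆ T → Prod K M N ⊆ M
  Prod-⊆ˡ mM N⊆T (p-zero eq) = resp (sym eq) has-0
    where open IsSModule mM
  Prod-⊆ˡ mM N⊆T (p-step {m = m} {n = n} Mm Nn rest eq) =
    resp (sym eq) (+-closed (resp (*-comm n m) (smul (N⊆T Nn) Mm)) (Prod-⊆ˡ mM N⊆T rest))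
    where open IsSModule mM

  ^⁺-⊆ : ∀ {T M} → IsSModule K T M → M ⊆ T → ∀ k → _^⁺_ K M k ⊆ M
  ^⁺-⊆ mM M⊆T zero    = λ Mx → Mx
  ^⁺-⊆ mM M⊆T (suc k) = Prod-⊆ˡ mM (λ Mᵏx → M⊆T (^⁺-⊆ mM M⊆T k Mᵏx))

  Prod-rescale : ∀ {R M L b} → M ⊆ b · R → Prod K M L ⊆ Prod K (b · L) R
  Prod-rescale M⊆bR (p-zero eq) = p-zero eq
  Prod-rescale {b = b} M⊆bR (p-step {m = m} {n = l} Mm Ll rest eq)
    with r , Rr , m≈br ← M⊆bR Mm =
    p-step (l , Ll , refl) Rr (Prod-rescale M⊆bR rest)
      (trans eq (+-congʳ (trans (*-congʳ m≈br) (xy∙z≈xz∙y b r l))))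

  absorb : ∀ {T I U} → IsSModule K T U → Prod K I T 1# →
           ∀ {y} → (∀ {z} → I z → U (z * y)) → U y
  absorb {T} {I} {U} mU 1∈IT {y} Iy⊆U = resp (*-identityˡ y) (go 1∈IT)
    where
    open IsSModule mU
    go : ∀ {w} → Prod K I T w → U (w * y)
    go (p-zero eq) = resp (sym (trans (*-congʳ eq) (zeroˡ y))) has-0
    go (p-step {m = i} {n = t} {y = w} Ii Tt rest eq) =
      resp (sym (trans (*-congʳ eq) (solve 4 (λ i t w y →
        (i :* t :+ w) :* y := t :* (i :* y) :+ w :* y) refl i t w y)))
        (+-closed (smul Tt (Iy⊆U Ii)) (go rest))

  absorb-^⁺ : ∀ {T I U} → IsSModule K T U → Prod K I T 1# →
              ∀ k {y} → (∀ {z} → _^⁺_ K I k z → U (z * y)) → U y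
  absorb-^⁺ mU 1∈IT zero    Iy⊆U = absorb mU 1∈IT Iy⊆U
  absorb-^⁺ mU 1∈IT (suc k) {y} Iᵏ⁺¹y⊆U = absorb-^⁺ mU 1∈IT k λ {z} Iᵏz →
    absorb mU 1∈IT λ {i} Ii →
      IsSModule.resp mU (*-assoc i z y) (Iᵏ⁺¹y⊆U (∈Prod Ii Iᵏz))

  ^-closed : ∀ {A} → IsSubring K A → ∀ {x} → A x → ∀ k → A (x ^ k)
  ^-closed sA Ax zero    = IsSubring.has-1 sA
  ^-closed sA Ax (suc k) = IsSubring.*-closed sA Ax (^-closed sA Ax k)

  module _ (S : Subset K) where

    Unit-resp : ∀ {A x y} → IsSubring K A → x ≈ y → Unit K S A x → Unit K S A y
    Unit-resp sA x≈y (Ax , x⁻¹ , xˣ¹ , xx⁻¹≈1) =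
      IsSubring.resp sA x≈y Ax , x⁻¹ , xˣ¹ , trans (*-congʳ (sym x≈y)) xx⁻¹≈1

    Unit-inverse : ∀ {A x y} → A x → A y → x * y ≈ 1# → Unit K S A y
    Unit-inverse Ax Ay xy≈1 = Ay , _ , Ax , trans (*-comm _ _) xy≈1

    Unit-* : ∀ {A x y} → IsSubring K A → Unit K S A x → Unit K S A y → Unit K S A (x * y)
    Unit-* sA (Ax , x⁻¹ , xˣ¹ , xx⁻¹≈1) (Ay , y⁻¹ , Ay⁻¹ , yy⁻¹≈1) =
      *-closed Ax Ay , x⁻¹ * y⁻¹ , *-closed xˣ¹ Ay⁻¹ ,
      trans (interchange _ _ _ _) (trans (*-cong xx⁻¹≈1 yy⁻¹≈1) (*-identityˡ 1#))
      where open IsSubring sA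

    Unit-^ : ∀ {A x} → IsSubring K A → Unit K S A x → ∀ k → Unit K S A (x ^ k)
    Unit-^ sA xˣ zero    = has-1 , 1# , has-1 , *-identityˡ 1#
      where open IsSubring sA
    Unit-^ sA xˣ (suc k) = Unit-* sA xˣ (Unit-^ sA xˣ k)

    Unit-^-suc⇒Unit : ∀ {A} → IsSubring K A → ∀ {x} → A x → ∀ k → Unit K S A (x ^ suc k) → Unit K S A x
    Unit-^-suc⇒Unit sA {x} Ax k (_ , y , Ay , xᵏ⁺¹y≈1) =
      Ax , x ^ k * y , *-closed (^-closed sA Ax k) Ay , trans (sym (*-assoc _ _ _)) xᵏ⁺¹y≈1
      where open IsSubring sA

    Unit-cancel : IsSubring K S → ∀ {s s′ v w z} → Unit K S S s → Unit K S S s′ →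
                  v * w ≈ 1# → s * v * z ≈ s′ * v → Unit K S S z
    Unit-cancel sS {s} {s′} {v} {w} {z} (Ss , s⁻¹ , Ss⁻¹ , ss⁻¹≈1) s′ˣ vw≈1 svz≈s′v =
      Unit-resp sS s⁻¹s′≈z (Unit-* sS (Unit-inverse Ss Ss⁻¹ ss⁻¹≈1) s′ˣ)
      where
      sz≈s′ : s * z ≈ s′
      sz≈s′ = begin
        s * z            ≈⟨ *-identityʳ _ ⟨
        s * z * 1#       ≈⟨ *-congˡ vw≈1 ⟨
        s * z * (v * w)  ≈⟨ solve 4 (λ s z v w → s :* z :* (v :* w) := s :* v :* z :* w) refl s z v w ⟩
        s * v * z * w    ≈⟨ *-congʳ svz≈s′v ⟩
        s′ * v * w       ≈⟨ *-assoc s′ v w ⟩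
        s′ * (v * w)     ≈⟨ *-congˡ vw≈1 ⟩
        s′ * 1#          ≈⟨ *-identityʳ s′ ⟩
        s′               ∎
      s⁻¹s′≈z : s⁻¹ * s′ ≈ z
      s⁻¹s′≈z = begin
        s⁻¹ * s′       ≈⟨ *-congˡ sz≈s′ ⟨
        s⁻¹ * (s * z)  ≈⟨ *-assoc s⁻¹ s z ⟨
        s⁻¹ * s * z    ≈⟨ *-congʳ (trans (*-comm s⁻¹ s) ss⁻¹≈1) ⟩
        1# * z         ≈⟨ *-identityˡ z ⟩
        z              ∎

    -- Pigeonhole on the cosets of x⁰, …, xᵐ, where m is the number of cosets.
    FiniteIndex⇒Unit-^-suc : ∀ {R} → IsSubring K S → IsSubring K R → FiniteIndex K S R →
                             ∀ {x} → Unit K S R x → ∃ λ k → Unit K S S (x ^ suc k)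
    FiniteIndex⇒Unit-^-suc sS sR (m , u , uˣ , cover) {x} xˣ
      = let i , j , i<j , rᵢ≡rⱼ = pigeonhole (n<1+n m) (λ k → proj₁ (coset (toℕ k)))
            o , 1+i+o≡j = m≤n⇒∃[o]m+o≡n i<j
        in o , collide (toℕ i) (toℕ j) o (≡.trans (+-suc (toℕ i) o) 1+i+o≡j) rᵢ≡rⱼ
      where
      coset : ∀ k → ∃₂ λ r s → Unit K S S s × (x ^ k ≈ s * u r)
      coset k = cover (x ^ k) (Unit-^ sR xˣ k)

      collide : ∀ i j o → i ℕ.+ suc o ≡.≡ j → proj₁ (coset i) ≡.≡ proj₁ (coset j) →
                Unit K S S (x ^ suc o)
      collide i j o i+1+o≡j rᵢ≡rⱼ =
        let r , s , sˣ , xⁱ≈suᵣ = coset i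
            r′ , s′ , s′ˣ , xʲ≈s′uᵣ′ = coset j
            _ , _ , _ , uᵣw≈1 = uˣ r
        in Unit-cancel sS sˣ s′ˣ uᵣw≈1 (begin
          s * u r * x ^ suc o    ≈⟨ *-congʳ xⁱ≈suᵣ ⟨
          x ^ i * x ^ suc o      ≈⟨ ^-homo-* x i (suc o) ⟨
          x ^ (i ℕ.+ suc o)      ≈⟨ reflexive (≡.cong (x ^_) i+1+o≡j) ⟩
          x ^ j                  ≈⟨ xʲ≈s′uᵣ′ ⟩
          s′ * u r′              ≈⟨ *-congˡ (reflexive (≡.cong u (≡.sym rᵢ≡rⱼ))) ⟩
          s′ * u r               ∎)

    ·-Nonzero : IsField K → ∀ {M b} → ¬ b ≈ 0# → Nonzero K S M → Nonzero K S (b · M)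
    ·-Nonzero fld b≉0 (m , Mm , m≉0) = _ , (m , Mm , refl) , *-nonzero fld b≉0 m≉0

    integral⇒IsFractionalIdeal : ¬ 1# ≈ 0# → IsSubring K S → ∀ {M} → IsSModule K S M →
                                 Nonzero K S M → M ⊆ S → IsFractionalIdeal K S M
    integral⇒IsFractionalIdeal 1≉0 sS mM M≠0 M⊆S =
      mM , M≠0 , 1# , has-1 , 1≉0 , λ {m} Mm → resp (sym (*-identityˡ m)) (M⊆S Mm)
      where open IsSubring sS

    module _ {R : Subset K} (sS : IsSubring K S) (sR : IsSubring K R) (S⊆R : S ⊆ R) where

      Span₂⊆·R : ∀ {x a b} → R x → x * b ≈ a → Span₂ S a b ⊆ b · R
      Span₂⊆·R {x} {b = b} Rx xb≈a = Span₂-least bR-module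
        (x , Rx , trans (sym xb≈a) (*-comm x b)) (1# , IsSubring.has-1 sR , sym (*-identityʳ b))
        where bR-module = IsSModule-restrict S⊆R (·-IsSModule b (IsSubring⇒IsSModule sR))

      1∈IR⇒Unit : ∀ {I π} → Prod K I R 1# → ∀ n → _^⁺_ K I n ⊆ π · S → R π → Unit K S R π
      1∈IR⇒Unit {π = π} 1∈IR n Iⁿ⊆πS Rπ =
        let r , Rr , 1≈πr = absorb-^⁺ (·-IsSModule π (IsSubring⇒IsSModule sR)) 1∈IR n {1#}
              λ {z} Iⁿz → let s , Ss , z≈πs = Iⁿ⊆πS Iⁿz in s , S⊆R Ss , trans (*-identityʳ z) z≈πs
        in Rπ , r , Rr , sym 1≈πr

      1∈IR⇒1∈I : ClassGroupTorsion K S → FiniteIndex K S R →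
                 ∀ {I} → IsFractionalIdeal K S I → I ⊆ S → Prod K I R 1# → I 1#
      1∈IR⇒1∈I tor fi {I} I-frac I⊆S 1∈IR =
        let n , π , _ , Iⁿ⊆πS , πS⊆Iⁿ = tor I I-frac
            Iⁿ⊆I = ^⁺-⊆ (proj₁ I-frac) I⊆S n
            Sπ = I⊆S (Iⁿ⊆I (πS⊆Iⁿ (1# , IsSubring.has-1 sS , sym (*-identityʳ π))))
            k , πᵏ⁺¹ˣ = FiniteIndex⇒Unit-^-suc sS sR fi (1∈IR⇒Unit 1∈IR n Iⁿ⊆πS (S⊆R Sπ))
            _ , π⁻¹ , Sπ⁻¹ , ππ⁻¹≈1 = Unit-^-suc⇒Unit sS Sπ k πᵏ⁺¹ˣ
        in Iⁿ⊆I (πS⊆Iⁿ (π⁻¹ , Sπ⁻¹ , sym ππ⁻¹≈1))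

      fraction∈S : IsField K → IsDedekind K S → ClassGroupTorsion K S → FiniteIndex K S R →
                   ∀ {x a b} → R x → S a → S b → ¬ b ≈ 0# → x * b ≈ a → S x
      fraction∈S fld ded tor fi {x} {a} {b} Rx Sa Sb b≉0 xb≈a =
        let N-ideal : IsNonzeroIdeal K S (Span₂ S a b)
            N-ideal = Span₂-IsSModule sS a b , Span₂-least (IsSubring⇒IsSModule sS) Sa Sb ,
                      b , ∈Span₂ʳ sS a b , b≉0
            L , (L-module , L≠0 , _) , NL⊆S , S⊆NL = ded (Span₂ S a b) N-ideal
            I⊆S : b · L ⊆ S
            I⊆S = λ { (l , Ll , y≈bl) → resp (sym y≈bl) (NL⊆S (∈Prod (∈Span₂ʳ sS a b) Ll)) }
            I-frac = integral⇒IsFractionalIdeal (proj₁ fld) sS (·-IsSModule b L-module)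
                       (·-Nonzero fld b≉0 L≠0) I⊆S
            1∈IR = Prod-rescale (Span₂⊆·R Rx xb≈a) (S⊆NL has-1)
            l , Ll , 1≈bl = 1∈IR⇒1∈I tor fi I-frac I⊆S 1∈IR
        in resp (sym (begin
             x            ≈⟨ *-identityʳ x ⟨
             x * 1#       ≈⟨ *-congˡ 1≈bl ⟩
             x * (b * l)  ≈⟨ *-assoc x b l ⟨
             x * b * l    ≈⟨ *-congʳ xb≈a ⟩
             a * l        ∎))
           (NL⊆S (∈Prod (∈Span₂ˡ sS a b) Ll))
        where open IsSubring sS

lemma3p6 : ∀ {c ℓ : Level} (K : CommutativeRing c ℓ) (S R : Subset K) →
    IsField K → IsSubring K S → IsFractionFieldOf K S →
    IsDedekind K S → ClassGroupTorsion K S →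
    IsSubring K R → S ⊆ R → ¬ Same K S R →
    ¬ FiniteIndex K S R
lemma3p6 K S R fld sS frac ded tor sR S⊆R S≠R fi = S≠R (S⊆R , R⊆S)
  where
  R⊆S : R ⊆ S
  R⊆S {x} Rx =
    let a , b , Sa , Sb , b≉0 , xb≈a = frac x
    in fraction∈S K S sS sR S⊆R fld ded tor fi Rx Sa Sb b≉0 xb≈a
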